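{- Let $r\geq 1$, let $\mathbf a=(a_1,\ldots,a_r)$ be positive integers, let $D$ be a common multiple of $a_1,\ldots,a_r$, and let $\sigma=a_1+\cdots+a_r$. For an integer $n\geq 0$ put $j_0:=\lceil \frac{n+\sigma}{D} \rceil - r$ and $k:= \lfloor \frac{n}{D}\rfloor - j_0$. Then $$ (r-1)!\,p_{\mathbf a}(n) \equiv 0 \pmod{(j_0+k+1)(j_0+k+2)\cdots (j_0+r-1)}, $$ where the modulus is the empty product $1$ if $k\geq r-1$.
   Context: $p_{\mathbf a}(n)$ is the restricted partition function: the number of integer solutions $(x_1,\ldots,x_r)$ of $a_1x_1+\cdots+a_rx_r=n$ with all $x_i\geq 0$. -}

module Defs where

open import Data.Nat as ℕ using (ℕ; zero; suc; _≤ᵇ_)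
open import Data.Nat.DivMod using (_/_)
open import Data.Bool using (if_then_else_)
open import Data.Vec using (Vec; []; _∷_)
open import Data.Integer as ℤ using (ℤ; +_; -[1+_])

-- Restricted partition function p_a(n): the number of tuples
-- (x_1,...,x_r) of naturals with a_1 x_1 + ... + a_r x_r = n.
-- Computed by counting over the value x_1 ∈ {0,...,n} of the first
-- coordinate (any solution has x_1 ≤ n when a_1 ≥ 1; for a_1 = 0 this
-- enumeration is not used by the statement, which assumes a_i ≥ 1).
-- countSols a n m  counts solutions with first coordinate x_1 < m.
mutual
  p : ∀ {r} → Vec ℕ r → ℕ → ℕ
  p [] zero = 1
  p [] (suc _) = 0
  p (a ∷ as) n = countSols a as n (suc n)

  countSols : ∀ {r} → ℕ → Vec ℕ r → ℕ → ℕ → ℕ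
  countSols a as n zero = 0
  countSols a as n (suc m) =
    countSols a as n m ℕ.+ (if a ℕ.* m ≤ᵇ n then p as (n ℕ.∸ a ℕ.* m) else 0)

vsum : ∀ {r} → Vec ℕ r → ℕ
vsum [] = 0
vsum (a ∷ as) = a ℕ.+ vsum as

⌈_/_⌉ : (m D : ℕ) → .{{_ : ℕ.NonZero D}} → ℕ
⌈ m / D ⌉ = (m ℕ.+ (D ℕ.∸ 1)) / D

⌊_/_⌋ : (m D : ℕ) → .{{_ : ℕ.NonZero D}} → ℕ
⌊ m / D ⌋ = m / D

prodLen : ℤ → ℕ → ℤ
prodLen x zero = ℤ.1ℤ
prodLen x (suc m) = x ℤ.* prodLen (x ℤ.+ ℤ.1ℤ) m

rangeProd : ℤ → ℤ → ℤ
rangeProd x y with (y ℤ.- x) ℤ.+ ℤ.1ℤ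
... | + m = prodLen x m
... | -[1+ _ ] = ℤ.1ℤ

j₀ : ∀ {r} → Vec ℕ r → (D n : ℕ) → .{{_ : ℕ.NonZero D}} → ℤ
j₀ {r} a D n = + ⌈ n ℕ.+ vsum a / D ⌉ ℤ.- + r

kk : ∀ {r} → Vec ℕ r → (D n : ℕ) → .{{_ : ℕ.NonZero D}} → ℤ
kk a D n = + ⌊ n / D ⌋ ℤ.- j₀ a D n

-- With D a common multiple of the aᵢ, the generating function of p_a is
--   ∏ᵢ (1 + t^{aᵢ} + ⋯ + t^{D − aᵢ}) / (1 − t^D)^r,
-- so p_a(n) is a sum of shifts p_{(D,…,D)}(n − u) by exponents u ≤ rD − σ of the
-- numerator.  A shifted term is zero unless n − u = QD, and then
-- (r − 1)! p_{(D,…,D)}(QD) = (Q + 1)(Q + 2)⋯(Q + r − 1).  Since Q ≤ ⌊n/D⌋ and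
-- Q + r ≥ ⌈(n + σ)/D⌉, each such product contains the consecutive factors
-- ⌊n/D⌋ + 1, …, ⌈(n + σ)/D⌉ − 1, which form the modulus.

module Submission where

open import Data.Bool using (true; false; if_then_else_)
open import Data.Fin using (zero; suc)
import Data.Integer as ℤ
import Data.Integer.Divisibility as ℤ
open import Data.Integer.Properties using (pos-*; +-injective)
import Data.Integer.Tactic.RingSolver as ℤ-Solver
open import Data.List using (List; []; _∷_; _++_; map; iterate; concatMap)
open import Data.List.Properties using (map-++)
open import Data.List.Relation.Unary.All as All using (All; []; _∷_)
open import Data.List.Relation.Unary.All.Properties using (concat⁺; map⁺)
open import Data.Nat
open import Data.Nat.Divisibility
open import Data.Nat.DivMod using (_/_; _%_; m≡m%n+[m/n]*n; m%n<n; m/n*n≤m)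
open import Data.Nat.Induction using (<-rec)
open import Data.Nat.Properties
open import Data.Nat.Tactic.RingSolver using (solve-∀)
open import Data.Vec using (Vec; []; _∷_; lookup; replicate)
open import Function using (_∘_)
open import Relation.Binary.PropositionalEquality
open import Relation.Nullary using (contradiction)
open import Defs

data Position (u : ℕ) : ℕ → Set where
  before : ∀ {n} → n < u → Position u n
  after  : ∀ w → Position u (u + w)

position : ∀ u n → Position u n
position zero    n       = after n
position (suc u) zero    = before z<s
position (suc u) (suc n) with position u n
... | before n<u = before (s<s n<u)
... | after w    = after w

-- delay f u is f shifted u places to the right: its generating function is
-- t^u times that of f.
delay : (ℕ → ℕ) → ℕ → ℕ → ℕ
delay f zero    n       = f n
delay f (suc u) zero    = 0
delay f (suc u) (suc n) = delay f u n

delay-below : ∀ f {u n} → n < u → delay f u n ≡ 0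
delay-below f {suc u} {zero}  _         = refl
delay-below f {suc u} {suc n} (s<s n<u) = delay-below f n<u

delay-exact : ∀ f u w → delay f u (u + w) ≡ f w
delay-exact f zero    w = refl
delay-exact f (suc u) w = delay-exact f u w

delay-zero : ∀ u n → delay (λ _ → 0) u n ≡ 0
delay-zero zero    n       = refl
delay-zero (suc u) zero    = refl
delay-zero (suc u) (suc n) = delay-zero u n

delay-delay : ∀ f v u n → delay (delay f v) u n ≡ delay f (u + v) n
delay-delay f v zero    n       = refl
delay-delay f v (suc u) zero    = refl
delay-delay f v (suc u) (suc n) = delay-delay f v u n

delay-additive : ∀ {f g h} → (∀ n → f n ≡ g n + h n) →
                 ∀ u n → delay f u n ≡ delay g u n + delay h u n
delay-additive f≡g+h zero    n       = f≡g+h n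
delay-additive f≡g+h (suc u) zero    = refl
delay-additive f≡g+h (suc u) (suc n) = delay-additive f≡g+h u n

delay-local : ∀ {f g} u n → (∀ m → m + u ≤ n → f m ≡ g m) → delay f u n ≡ delay g u n
delay-local zero    n       f≡g = f≡g n (≤-reflexive (+-identityʳ n))
delay-local (suc u) zero    f≡g = refl
delay-local (suc u) (suc n) f≡g =
  delay-local u n (λ m m+u≤n → f≡g m (subst (_≤ suc n) (sym (+-suc m u)) (s≤s m+u≤n)))

delay-recurrence-unique : ∀ {a} {g F F′ : ℕ → ℕ} → 1 ≤ a →
                          (∀ n → F n ≡ g n + delay F a n) →
                          (∀ n → F′ n ≡ g n + delay F′ a n) →
                          ∀ n → F n ≡ F′ n
delay-recurrence-unique {a} {g} {F} {F′} 1≤a F-rec F′-rec = <-rec (λ n → F n ≡ F′ n) agree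
  where
  agree : ∀ n → (∀ {m} → m < n → F m ≡ F′ m) → F n ≡ F′ n
  agree n ih = begin
    F n                 ≡⟨ F-rec n ⟩
    g n + delay F a n   ≡⟨ cong (g n +_) (delay-local a n λ m m+a≤n → ih (<-≤-trans (m<m+n m 1≤a) m+a≤n)) ⟩
    g n + delay F′ a n  ≡⟨ F′-rec n ⟨
    F′ n                ∎
    where open ≡-Reasoning

s≤ᵇs : ∀ m n → (suc m ≤ᵇ suc n) ≡ (m ≤ᵇ n)
s≤ᵇs zero    n = refl
s≤ᵇs (suc m) n = refl

+-cancelˡ-≤ᵇ : ∀ a m n → (a + m ≤ᵇ a + n) ≡ (m ≤ᵇ n)
+-cancelˡ-≤ᵇ zero    m n = refl
+-cancelˡ-≤ᵇ (suc a) m n = trans (s≤ᵇs (a + m) (a + n)) (+-cancelˡ-≤ᵇ a m n)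

if-≤ᵇ-false : ∀ {m n} v → n < m → (if m ≤ᵇ n then v else 0) ≡ 0
if-≤ᵇ-false {m} {n} v n<m with m ≤ᵇ n | ≤ᵇ⇒≤ m n
... | true  | m≤n = contradiction (m≤n _) (<⇒≱ n<m)
... | false | _   = refl

module _ {r} (a : ℕ) (as : Vec ℕ r) where

  countSols-shift : ∀ n m → countSols a as (a + n) (suc m) ≡ p as (a + n) + countSols a as n m
  countSols-shift n zero rewrite *-zeroʳ a = sym (+-identityʳ _)
  countSols-shift n (suc m) = begin
    countSols a as (a + n) (suc m) + (if a * suc m ≤ᵇ a + n then p as (a + n ∸ a * suc m) else 0)
      ≡⟨ cong₂ _+_ (countSols-shift n m) (cong₂ (λ b k → if b then p as k else 0) guard≡ argument≡) ⟩
    p as (a + n) + countSols a as n m + (if a * m ≤ᵇ n then p as (n ∸ a * m) else 0)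
      ≡⟨ +-assoc (p as (a + n)) _ _ ⟩
    p as (a + n) + countSols a as n (suc m) ∎
    where
    open ≡-Reasoning
    guard≡ : (a * suc m ≤ᵇ a + n) ≡ (a * m ≤ᵇ n)
    guard≡ = trans (cong (_≤ᵇ a + n) (*-suc a m)) (+-cancelˡ-≤ᵇ a (a * m) n)
    argument≡ : a + n ∸ a * suc m ≡ n ∸ a * m
    argument≡ = trans (cong (a + n ∸_) (*-suc a m)) ([m+n]∸[m+o]≡n∸o a n (a * m))

  countSols-stable : ∀ {n m} k → n < a * m → countSols a as n (m + k) ≡ countSols a as n m
  countSols-stable {n} {m} zero    _    = cong (countSols a as n) (+-identityʳ m)
  countSols-stable {n} {m} (suc k) n<am = begin
    countSols a as n (m + suc k)
      ≡⟨ cong (countSols a as n) (+-suc m k) ⟩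
    countSols a as n (m + k) + (if a * (m + k) ≤ᵇ n then p as (n ∸ a * (m + k)) else 0)
      ≡⟨ cong (countSols a as n (m + k) +_) (if-≤ᵇ-false _ (<-≤-trans n<am (*-monoʳ-≤ a (m≤m+n m k)))) ⟩
    countSols a as n (m + k) + 0
      ≡⟨ +-identityʳ _ ⟩
    countSols a as n (m + k)
      ≡⟨ countSols-stable k n<am ⟩
    countSols a as n m ∎
    where open ≡-Reasoning

  p-∷-below : ∀ {n} → n < a → p (a ∷ as) n ≡ p as n
  p-∷-below {n} n<a = trans (countSols-stable n (subst (n <_) (sym (*-identityʳ a)) n<a)) first-term
    where
    first-term : countSols a as n 1 ≡ p as n
    first-term rewrite *-zeroʳ a = refl

  p-∷-step : 1 ≤ a → ∀ n → p (a ∷ as) (a + n) ≡ p as (a + n) + p (a ∷ as) n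
  p-∷-step 1≤a n = trans (countSols-shift n (a + n)) (cong (p as (a + n) +_) saturated)
    where
    a+n≡ : a + n ≡ suc n + (a ∸ 1)
    a+n≡ = trans (+-comm a n) (trans (cong (n +_) (sym (m+[n∸m]≡n 1≤a))) (+-suc n (a ∸ 1)))
    saturated : countSols a as n (a + n) ≡ countSols a as n (suc n)
    saturated = trans (cong (countSols a as n) a+n≡)
      (countSols-stable (a ∸ 1) (<-≤-trans (n<1+n n) (m≤n*m (suc n) a {{>-nonZero 1≤a}})))

  -- the generating function identity (1 − t^a) P_{a ∷ as} = P_{as}
  p-∷-recurrence : 1 ≤ a → ∀ n → p (a ∷ as) n ≡ p as n + delay (p (a ∷ as)) a n
  p-∷-recurrence 1≤a n with position a n
  ... | before n<a = trans (p-∷-below n<a) (sym (trans (cong (p as n +_) (delay-below _ n<a)) (+-identityʳ _)))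
  ... | after w    = trans (p-∷-step 1≤a w) (cong (p as (a + w) +_) (sym (delay-exact _ a w)))

-- A list us stands for the polynomial Σ_{u ∈ us} t^u, and us ⋆ f for its
-- product with the generating function of f.
_⋆_ : List ℕ → (ℕ → ℕ) → ℕ → ℕ
([]       ⋆ f) n = 0
((u ∷ us) ⋆ f) n = delay f u n + (us ⋆ f) n

⋆-++ : ∀ us vs f n → ((us ++ vs) ⋆ f) n ≡ (us ⋆ f) n + (vs ⋆ f) n
⋆-++ []       vs f n = refl
⋆-++ (u ∷ us) vs f n = trans (cong (delay f u n +_) (⋆-++ us vs f n)) (sym (+-assoc (delay f u n) ((us ⋆ f) n) ((vs ⋆ f) n)))

⋆-delay : ∀ us f a n → delay (us ⋆ f) a n ≡ (map (a +_) us ⋆ f) n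
⋆-delay []       f a n = delay-zero a n
⋆-delay (u ∷ us) f a n =
  trans (delay-additive (λ _ → refl) a n) (cong₂ _+_ (delay-delay f u a n) (⋆-delay us f a n))

map-iterate : ∀ {A : Set} (f : A → A) x k → map f (iterate f x k) ≡ iterate f (f x) k
map-iterate f x zero    = refl
map-iterate f x (suc k) = cong (f x ∷_) (map-iterate f (f x) k)

⋆-iterate-last : ∀ a u k f n →
                 (iterate (a +_) u (suc k) ⋆ f) n ≡ (iterate (a +_) u k ⋆ f) n + delay f (a * k + u) n
⋆-iterate-last a u zero    f n rewrite *-zeroʳ a = +-identityʳ _
⋆-iterate-last a u (suc k) f n = begin
  delay f u n + (iterate (a +_) (a + u) (suc k) ⋆ f) n
    ≡⟨ cong (delay f u n +_) (⋆-iterate-last a (a + u) k f n) ⟩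
  delay f u n + ((iterate (a +_) (a + u) k ⋆ f) n + delay f (a * k + (a + u)) n)
    ≡⟨ +-assoc (delay f u n) _ _ ⟨
  (iterate (a +_) u (suc k) ⋆ f) n + delay f (a * k + (a + u)) n
    ≡⟨ cong (λ v → (iterate (a +_) u (suc k) ⋆ f) n + delay f v n) (shift a k u) ⟩
  (iterate (a +_) u (suc k) ⋆ f) n + delay f (a * suc k + u) n ∎
  where
  open ≡-Reasoning
  shift : ∀ a k u → a * k + (a + u) ≡ a * suc k + u
  shift = solve-∀

-- the exponents of t^u (1 + t^a + ⋯ + t^{e a})
progression : ℕ → ℕ → ℕ → List ℕ
progression a e u = iterate (a +_) u (suc e)

iterate-bounded : ∀ a k u → All (λ v → a + v ≤ a * k + u) (iterate (a +_) u k)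
iterate-bounded a zero    u = []
iterate-bounded a (suc k) u =
  +-monoˡ-≤ u (m≤m*n a (suc k)) ∷
  subst (λ c → All (λ v → a + v ≤ c) (iterate (a +_) (a + u) k)) (shift a k u) (iterate-bounded a k (a + u))
  where
  shift : ∀ a k u → a * k + (a + u) ≡ a * suc k + u
  shift = solve-∀

-- If f = g + t^{a(e+1)} f, then t^u (1 + t^a + ⋯ + t^{ea}) f telescopes
-- against its own shift by t^a, leaving t^u g.
module _ (a e : ℕ) {f g : ℕ → ℕ} (recurrence : ∀ n → f n ≡ g n + delay f (a * suc e) n) where

  progression-telescopes : ∀ u n →
    (progression a e u ⋆ f) n ≡ delay g u n + (map (a +_) (progression a e u) ⋆ f) n
  progression-telescopes u n = begin
    delay f u n + S
      ≡⟨ cong (_+ S) (delay-additive recurrence u n) ⟩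
    delay g u n + delay (delay f D) u n + S
      ≡⟨ cong (λ x → delay g u n + x + S) (delay-delay f D u n) ⟩
    delay g u n + delay f (u + D) n + S
      ≡⟨ +-assoc (delay g u n) _ S ⟩
    delay g u n + (delay f (u + D) n + S)
      ≡⟨ cong (delay g u n +_) (+-comm _ S) ⟩
    delay g u n + (S + delay f (u + D) n)
      ≡⟨ cong (λ v → delay g u n + (S + delay f v n)) (last≡ a e u) ⟩
    delay g u n + (S + delay f (a * e + (a + u)) n)
      ≡⟨ cong (delay g u n +_) (⋆-iterate-last a (a + u) e f n) ⟨
    delay g u n + (iterate (a +_) (a + u) (suc e) ⋆ f) n
      ≡⟨ cong (λ vs → delay g u n + (vs ⋆ f) n) (map-iterate (a +_) u (suc e)) ⟨
    delay g u n + (map (a +_) (progression a e u) ⋆ f) n ∎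
    where
    open ≡-Reasoning
    D = a * suc e
    S = (iterate (a +_) (a + u) e ⋆ f) n
    last≡ : ∀ a e u → u + a * suc e ≡ a * e + (a + u)
    last≡ = solve-∀

  progressions-telescope : ∀ us n →
    (concatMap (progression a e) us ⋆ f) n ≡ (us ⋆ g) n + (map (a +_) (concatMap (progression a e) us) ⋆ f) n
  progressions-telescope []       n = refl
  progressions-telescope (u ∷ us) n = begin
    ((B ++ C) ⋆ f) n
      ≡⟨ ⋆-++ B C f n ⟩
    (B ⋆ f) n + (C ⋆ f) n
      ≡⟨ cong₂ _+_ (progression-telescopes u n) (progressions-telescope us n) ⟩
    (delay g u n + (map (a +_) B ⋆ f) n) + ((us ⋆ g) n + (map (a +_) C ⋆ f) n)
      ≡⟨ interchange (delay g u n) _ _ _ ⟩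
    ((u ∷ us) ⋆ g) n + ((map (a +_) B ⋆ f) n + (map (a +_) C ⋆ f) n)
      ≡⟨ cong (((u ∷ us) ⋆ g) n +_) (⋆-++ (map (a +_) B) (map (a +_) C) f n) ⟨
    ((u ∷ us) ⋆ g) n + ((map (a +_) B ++ map (a +_) C) ⋆ f) n
      ≡⟨ cong (λ vs → ((u ∷ us) ⋆ g) n + (vs ⋆ f) n) (map-++ (a +_) B C) ⟨
    ((u ∷ us) ⋆ g) n + (map (a +_) (B ++ C) ⋆ f) n ∎
    where
    open ≡-Reasoning
    B = progression a e u
    C = concatMap (progression a e) us
    interchange : ∀ w x y z → (w + x) + (y + z) ≡ (w + y) + (x + z)
    interchange = solve-∀

∣*≡0 : ∀ {d} k {t} → t ≡ 0 → d ∣ k * t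
∣*≡0 {d} k refl = subst (d ∣_) (sym (*-zeroʳ k)) (d ∣0)

∣-⋆ : ∀ {d k f n} us → All (λ u → d ∣ k * delay f u n) us → d ∣ k * (us ⋆ f) n
∣-⋆ {k = k}             []       []        = ∣*≡0 k refl
∣-⋆ {d} {k} {f} {n} (u ∷ us) (d∣ ∷ d∣s) =
  subst (d ∣_) (sym (*-distribˡ-+ k (delay f u n) _)) (∣m∣n⇒∣m+n d∣ (∣-⋆ {d} {k} {f} {n} us d∣s))

rising : ℕ → ℕ → ℕ
rising x zero    = 1
rising x (suc m) = x * rising (suc x) m

rising-+ : ∀ x m k → rising x (m + k) ≡ rising x m * rising (x + m) k
rising-+ x zero    k = trans (cong (λ y → rising y k) (sym (+-identityʳ x))) (sym (*-identityˡ _))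
rising-+ x (suc m) k = begin
  x * rising (suc x) (m + k)                    ≡⟨ cong (x *_) (rising-+ (suc x) m k) ⟩
  x * (rising (suc x) m * rising (suc x + m) k) ≡⟨ *-assoc x _ _ ⟨
  rising x (suc m) * rising (suc x + m) k       ≡⟨ cong (λ y → rising x (suc m) * rising y k) (+-suc x m) ⟨
  rising x (suc m) * rising (x + suc m) k       ∎
  where open ≡-Reasoning

rising-suc : ∀ x m → rising x (suc m) ≡ rising x m * (x + m)
rising-suc x m = begin
  rising x (suc m)             ≡⟨ cong (rising x) (+-comm 1 m) ⟩
  rising x (m + 1)             ≡⟨ rising-+ x m 1 ⟩
  rising x m * ((x + m) * 1)   ≡⟨ cong (rising x m *_) (*-identityʳ (x + m)) ⟩
  rising x m * (x + m)         ∎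
  where open ≡-Reasoning

rising-1 : ∀ m → rising 1 m ≡ m !
rising-1 zero    = refl
rising-1 (suc m) = begin
  rising 1 (suc m)  ≡⟨ rising-suc 1 m ⟩
  rising 1 m * suc m ≡⟨ cong (_* suc m) (rising-1 m) ⟩
  m ! * suc m       ≡⟨ *-comm (m !) (suc m) ⟩
  suc m !           ∎
  where open ≡-Reasoning

rising-prefix-∣ : ∀ x {m l} → m ≤ l → rising x m ∣ rising x l
rising-prefix-∣ x {m} {l} m≤l =
  subst (rising x m ∣_) (trans (sym (rising-+ x m (l ∸ m))) (cong (rising x) (m+[n∸m]≡n m≤l)))
    (m∣m*n (rising (x + m) (l ∸ m)))

rising-suffix-∣ : ∀ x i m → rising (x + i) m ∣ rising x (i + m)
rising-suffix-∣ x i m = subst (rising (x + i) m ∣_) (sym (rising-+ x i m)) (n∣m*n (rising x i))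

rising-∣-rising : ∀ {x y m l} → x ≤ y → y + m ≤ x + l → rising y m ∣ rising x l
rising-∣-rising {x} {y} {m} {l} x≤y y+m≤x+l =
  ∣-trans (subst (λ z → rising z m ∣ rising x (i + m)) x+i≡y (rising-suffix-∣ x i m))
          (rising-prefix-∣ x (+-cancelˡ-≤ x (i + m) l (subst (_≤ x + l) y+m≡x+[i+m] y+m≤x+l)))
  where
  i = y ∸ x
  x+i≡y : x + i ≡ y
  x+i≡y = m+[n∸m]≡n x≤y
  y+m≡x+[i+m] : y + m ≡ x + (i + m)
  y+m≡x+[i+m] = trans (cong (_+ m) (sym x+i≡y)) (+-assoc x i m)

p-[]-positive : ∀ {n} → 0 < n → p [] n ≡ 0
p-[]-positive {suc n} _ = refl

module _ (D : ℕ) .{{_ : NonZero D}} where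

  G : ℕ → ℕ → ℕ
  G r = p (replicate r D)

  G-recurrence : ∀ r n → G (suc r) n ≡ G r n + delay (G (suc r)) D n
  G-recurrence r = p-∷-recurrence D (replicate r D) (>-nonZero⁻¹ D)

  G-at-0 : ∀ r → G r 0 ≡ 1
  G-at-0 zero    = refl
  G-at-0 (suc r) = trans (G-recurrence r 0) (cong₂ _+_ (G-at-0 r) (delay-below _ (>-nonZero⁻¹ D)))

  G-off-multiples : ∀ r Q {s} → 0 < s → s < D → G r (s + Q * D) ≡ 0
  G-off-multiples zero    Q       {suc s} _   _   = refl
  G-off-multiples (suc r) zero    {s}     0<s s<D = begin
    G (suc r) (s + 0)                              ≡⟨ G-recurrence r (s + 0) ⟩
    G r (s + 0) + delay (G (suc r)) D (s + 0)      ≡⟨ cong₂ _+_ (G-off-multiples r zero 0<s s<D)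
                                                              (delay-below _ (subst (_< D) (sym (+-identityʳ s)) s<D)) ⟩
    0                                              ∎
    where open ≡-Reasoning
  G-off-multiples (suc r) (suc Q) {s}     0<s s<D = begin
    G (suc r) (s + suc Q * D)                                   ≡⟨ cong (G (suc r)) s+D+QD≡ ⟩
    G (suc r) (D + (s + Q * D))                                 ≡⟨ G-recurrence r _ ⟩
    G r (D + (s + Q * D)) + delay (G (suc r)) D (D + (s + Q * D))
      ≡⟨ cong₂ _+_ (trans (cong (G r) (sym s+D+QD≡)) (G-off-multiples r (suc Q) 0<s s<D))
                   (trans (delay-exact _ D _) (G-off-multiples (suc r) Q 0<s s<D)) ⟩
    0                                                           ∎
    where
    open ≡-Reasoning
    s+D+QD≡ : s + suc Q * D ≡ D + (s + Q * D)
    s+D+QD≡ = trans (sym (+-assoc s D _)) (trans (cong (_+ Q * D) (+-comm s D)) (+-assoc D s _))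

  G-1-multiple : ∀ Q → G 1 (Q * D) ≡ 1
  G-1-multiple zero    = G-at-0 1
  G-1-multiple (suc Q) = trans (G-recurrence 0 (D + Q * D))
    (cong₂ _+_ (p-[]-positive (<-≤-trans (>-nonZero⁻¹ D) (m≤m+n D _)))
               (trans (delay-exact _ D (Q * D)) (G-1-multiple Q)))

  G-rising : ∀ r Q → r ! * G (suc r) (Q * D) ≡ rising (suc Q) r
  G-rising zero    Q       = trans (+-identityʳ _) (G-1-multiple Q)
  G-rising (suc r) zero    =
    trans (cong (suc r ! *_) (G-at-0 (suc (suc r)))) (trans (*-identityʳ _) (sym (rising-1 (suc r))))
  G-rising (suc r) (suc Q) = begin
    suc r ! * G (suc (suc r)) (D + Q * D)
      ≡⟨ cong (suc r ! *_) (G-recurrence (suc r) _) ⟩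
    suc r ! * (G (suc r) (suc Q * D) + delay (G (suc (suc r))) D (D + Q * D))
      ≡⟨ cong (λ x → suc r ! * (G (suc r) (suc Q * D) + x)) (delay-exact _ D (Q * D)) ⟩
    suc r ! * (G (suc r) (suc Q * D) + G (suc (suc r)) (Q * D))
      ≡⟨ *-distribˡ-+ (suc r !) _ _ ⟩
    suc r * r ! * G (suc r) (suc Q * D) + suc r ! * G (suc (suc r)) (Q * D)
      ≡⟨ cong (_+ suc r ! * G (suc (suc r)) (Q * D)) (*-assoc (suc r) (r !) _) ⟩
    suc r * (r ! * G (suc r) (suc Q * D)) + suc r ! * G (suc (suc r)) (Q * D)
      ≡⟨ cong₂ (λ x y → suc r * x + y) (G-rising r (suc Q)) (G-rising (suc r) Q) ⟩
    suc r * R + suc Q * R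
      ≡⟨ collect r Q R ⟩
    R * (suc (suc Q) + r)
      ≡⟨ rising-suc (suc (suc Q)) r ⟨
    rising (suc (suc Q)) (suc r) ∎
    where
    open ≡-Reasoning
    R = rising (suc (suc Q)) r
    collect : ∀ r Q R → suc r * R + suc Q * R ≡ R * (suc (suc Q) + r)
    collect = solve-∀

  rising-∣-G-multiple : ∀ r Q {x m} → Q * D < x * D → (x + m) * D < Q * D + suc (suc r) * D →
                        rising x m ∣ r ! * G (suc r) (Q * D)
  rising-∣-G-multiple r Q {x} {m} lower upper =
    subst (rising x m ∣_) (sym (G-rising r Q)) (rising-∣-rising (*-cancelʳ-< D Q x lower) x+m≤)
    where
    x+m≤ : x + m ≤ suc Q + r
    x+m≤ = ≤-pred (subst (x + m <_) (trans (+-suc Q (suc r)) (cong suc (+-suc Q r)))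
             (*-cancelʳ-< D (x + m) (Q + suc (suc r)) (subst ((x + m) * D <_) (sym (*-distribʳ-+ D Q _)) upper)))

  rising-∣-G : ∀ r w {x m} → w < x * D → (x + m) * D < w + suc (suc r) * D → rising x m ∣ r ! * G (suc r) w
  rising-∣-G r w {x} {m} lower upper =
    subst (λ v → rising x m ∣ r ! * G (suc r) v) (sym w≡) (by-residue (w % D) (m%n<n w D) w≡)
    where
    w≡ : w ≡ w % D + w / D * D
    w≡ = m≡m%n+[m/n]*n w D
    by-residue : ∀ s → s < D → w ≡ s + w / D * D → rising x m ∣ r ! * G (suc r) (s + w / D * D)
    by-residue zero    _   w≡QD = rising-∣-G-multiple r (w / D) {x} {m} (subst (_< x * D) w≡QD lower)
                                    (subst (λ v → (x + m) * D < v + suc (suc r) * D) w≡QD upper)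
    by-residue (suc s) s<D _    = ∣*≡0 (r !) (G-off-multiples (suc r) (w / D) z<s s<D)

  rising-∣-delay-G : ∀ r σ u n {x m} → u + σ ≤ suc r * D → n < x * D → (x + m) * D < n + σ + D →
                     rising x m ∣ r ! * delay (G (suc r)) u n
  rising-∣-delay-G r σ u n {x} {m} u+σ≤ lower upper with position u n
  ... | before n<u = ∣*≡0 (r !) (delay-below _ n<u)
  ... | after w    = subst (λ t → rising x m ∣ r ! * t) (sym (delay-exact _ u w))
                       (rising-∣-G r w {x} {m} (≤-<-trans (m≤n+m w u) lower) (<-≤-trans upper widen))
    where
    open ≤-Reasoning
    widen : u + w + σ + D ≤ w + suc (suc r) * D
    widen = begin
      u + w + σ + D        ≡⟨ regroup u w σ D ⟩
      w + (D + (u + σ))    ≤⟨ +-monoʳ-≤ w (+-monoʳ-≤ D u+σ≤) ⟩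
      w + (D + suc r * D)  ∎
      where
      regroup : ∀ u w σ D → u + w + σ + D ≡ w + (D + (u + σ))
      regroup = solve-∀

  -- The exponents are those of the numerator ∏ (1 + t^{aᵢ} + ⋯ + t^{D − aᵢ}).
  record Expansion {r} (as : Vec ℕ r) : Set where
    field
      exponents         : List ℕ
      exponents-bounded : All (λ u → u + vsum as ≤ r * D) exponents
      p≡⋆G              : ∀ n → p as n ≡ (exponents ⋆ G r) n

  expansion : ∀ {r} (as : Vec ℕ r) → (∀ i → 1 ≤ lookup as i) → (∀ i → lookup as i ∣ D) → Expansion as
  expansion [] _ _ = record
    { exponents         = 0 ∷ []
    ; exponents-bounded = z≤n ∷ []
    ; p≡⋆G              = λ n → sym (+-identityʳ (p [] n))
    }
  expansion {suc r} (a ∷ as) pos div with div zero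
  ... | divides zero    D≡0 = contradiction D≡0 (≢-nonZero⁻¹ D)
  ... | divides (suc e) D≡  = record
    { exponents         = concatMap (progression a e) us
    ; exponents-bounded = concat⁺ (map⁺ (All.map progression-bounded bounded))
    ; p≡⋆G              = delay-recurrence-unique {g = p as} {F = p (a ∷ as)} {F′ = F}
                            (pos zero) (p-∷-recurrence a as (pos zero)) F-recurrence
    }
    where
    open Expansion (expansion as (pos ∘ suc) (div ∘ suc)) renaming (exponents to us; exponents-bounded to bounded)
    D≡a*[1+e] : D ≡ a * suc e
    D≡a*[1+e] = trans D≡ (*-comm (suc e) a)
    F = concatMap (progression a e) us ⋆ G (suc r)
    F-recurrence : ∀ n → F n ≡ p as n + delay F a n
    F-recurrence n = begin
      F n
        ≡⟨ progressions-telescope a e (subst (λ c → ∀ n → G (suc r) n ≡ G r n + delay (G (suc r)) c n)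
                                             D≡a*[1+e] (G-recurrence r)) us n ⟩
      (us ⋆ G r) n + (map (a +_) (concatMap (progression a e) us) ⋆ G (suc r)) n
        ≡⟨ cong₂ _+_ (sym (p≡⋆G n)) (sym (⋆-delay (concatMap (progression a e) us) (G (suc r)) a n)) ⟩
      p as n + delay F a n ∎
      where open ≡-Reasoning
    progression-bounded : ∀ {u} → u + vsum as ≤ r * D → All (λ v → v + (a + vsum as) ≤ suc r * D) (progression a e u)
    progression-bounded {u} u+σ≤ = All.map step (iterate-bounded a (suc e) u)
      where
      open ≤-Reasoning
      step : ∀ {v} → a + v ≤ a * suc e + u → v + (a + vsum as) ≤ suc r * D
      step {v} a+v≤ = begin
        v + (a + vsum as)          ≡⟨ +-assoc v a _ ⟨
        v + a + vsum as            ≡⟨ cong (_+ vsum as) (+-comm v a) ⟩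
        a + v + vsum as            ≤⟨ +-monoˡ-≤ (vsum as) a+v≤ ⟩
        a * suc e + u + vsum as    ≡⟨ +-assoc (a * suc e) u _ ⟩
        a * suc e + (u + vsum as)  ≤⟨ +-monoʳ-≤ (a * suc e) u+σ≤ ⟩
        a * suc e + r * D          ≡⟨ cong (_+ r * D) D≡a*[1+e] ⟨
        suc r * D                  ∎

  rising-∣-p : ∀ r (as : Vec ℕ (suc r)) → (∀ i → 1 ≤ lookup as i) → (∀ i → lookup as i ∣ D) →
               ∀ {n x m} → n < x * D → (x + m) * D < n + vsum as + D → rising x m ∣ r ! * p as n
  rising-∣-p r as pos div {n} {x} {m} lower upper =
    subst (λ t → rising x m ∣ r ! * t) (sym (p≡⋆G n))
      (∣-⋆ {k = r !} {G (suc r)} {n} exponents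
        (All.map (λ {u} u+σ≤ → rising-∣-delay-G r (vsum as) u n {x} {m} u+σ≤ lower upper) exponents-bounded))
    where open Expansion (expansion as pos div)

<-suc⌊/⌋* : ∀ k D .{{_ : NonZero D}} → k < suc ⌊ k / D ⌋ * D
<-suc⌊/⌋* k D = subst (_< D + k / D * D) (sym (m≡m%n+[m/n]*n k D)) (+-monoˡ-< (k / D * D) (m%n<n k D))

⌈/⌉*<+ : ∀ k D .{{_ : NonZero D}} → ⌈ k / D ⌉ * D < k + D
⌈/⌉*<+ k D = ≤-<-trans (m/n*n≤m (k + (D ∸ 1)) D) (+-monoʳ-< k (m≤pred[n]⇒suc[m]≤n ≤-refl))

open import Data.Integer using (+_; -[1+_]; 1ℤ)

prodLen-+ : ∀ x m → prodLen (+ x) m ≡ + rising x m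
prodLen-+ x zero    = refl
prodLen-+ x (suc m) = begin
  + x ℤ.* prodLen (+ x ℤ.+ 1ℤ) m  ≡⟨ cong (λ y → + x ℤ.* prodLen (+ y) m) (+-comm x 1) ⟩
  + x ℤ.* prodLen (+ suc x) m     ≡⟨ cong (+ x ℤ.*_) (prodLen-+ (suc x) m) ⟩
  + x ℤ.* + rising (suc x) m      ≡⟨ pos-* x _ ⟨
  + rising x (suc m)              ∎
  where open ≡-Reasoning

rangeProd-∣ : ∀ X Y {z} → (∀ m → (Y ℤ.- X) ℤ.+ 1ℤ ≡ + m → prodLen X m ℤ.∣ z) → rangeProd X Y ℤ.∣ z
rangeProd-∣ X Y prodLen-∣ with (Y ℤ.- X) ℤ.+ 1ℤ | prodLen-∣
... | + m      | prodLen-∣′ = prodLen-∣′ m refl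
... | -[1+ _ ] | _          = 1∣ _

rangeProd-rising-∣ : ∀ x y {z} → (∀ m → y ≡ x + m → rising x m ∣ z) → rangeProd (+ x) (+ y ℤ.- 1ℤ) ℤ.∣ + z
rangeProd-rising-∣ x y {z} rising-∣ = rangeProd-∣ (+ x) (+ y ℤ.- 1ℤ) {+ z} λ m length≡ →
  subst (ℤ._∣ + z) (sym (prodLen-+ x m)) (rising-∣ m (y≡x+m m length≡))
  where
  y≡x+m : ∀ m → (+ y ℤ.- 1ℤ ℤ.- + x) ℤ.+ 1ℤ ≡ + m → y ≡ x + m
  y≡x+m m length≡ = trans (+-injective (trans (regroup (+ y) (+ x)) (cong (ℤ._+ + x) length≡))) (+-comm m x)
    where
    regroup : ∀ Y X → Y ≡ (Y ℤ.- 1ℤ ℤ.- X) ℤ.+ 1ℤ ℤ.+ X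
    regroup = ℤ-Solver.solve-∀

corollary2p4 : (r : ℕ) → r ≥ 1 → (a : Vec ℕ r) → (∀ i → lookup a i ≥ 1)
    → (D : ℕ) → .{{_ : NonZero D}} → (∀ i → lookup a i ∣ D)
    → (n : ℕ)
    → rangeProd (j₀ a D n ℤ.+ kk a D n ℤ.+ 1ℤ) (j₀ a D n ℤ.+ + r ℤ.- 1ℤ)
      ℤ.∣ (+ ((r ∸ 1) !) ℤ.* + p a n)
corollary2p4 (suc r) _ as pos D div n =
  subst₂ (λ X Y → rangeProd X Y ℤ.∣ + (r !) ℤ.* + p as n) (sym lower-end) (sym upper-end)
    (subst (rangeProd (+ suc q) (+ c ℤ.- 1ℤ) ℤ.∣_) (pos-* (r !) (p as n))
      (rangeProd-rising-∣ (suc q) c λ m c≡ →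
        rising-∣-p D r as pos div {n} {suc q} {m} (<-suc⌊/⌋* n D)
          (subst (λ y → y * D < n + vsum as + D) c≡ (⌈/⌉*<+ (n + vsum as) D))))
  where
  q = ⌊ n / D ⌋
  c = ⌈ n + vsum as / D ⌉
  lower-end : j₀ as D n ℤ.+ kk as D n ℤ.+ 1ℤ ≡ + suc q
  lower-end = trans (cancel (j₀ as D n) (+ q)) (cong +_ (+-comm q 1))
    where
    cancel : ∀ J Q → J ℤ.+ (Q ℤ.- J) ℤ.+ 1ℤ ≡ Q ℤ.+ 1ℤ
    cancel = ℤ-Solver.solve-∀
  upper-end : j₀ as D n ℤ.+ + suc r ℤ.- 1ℤ ≡ + c ℤ.- 1ℤ
  upper-end = cancel (+ c) (+ suc r)
    where
    cancel : ∀ C R → C ℤ.- R ℤ.+ R ℤ.- 1ℤ ≡ C ℤ.- 1ℤ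
    cancel = ℤ-Solver.solve-∀
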